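{- Let $T$ be a $[2]$-trade of volume $6$ which, as an element of the group ring $\mathbb Z[2^V]$, is represented as $$T=(1-Y_1)(1-Y_2)(1-Y_3)-(1-Z_1)(1-Z_2)(1-Y_1Y_2Y_3),$$ where $Y_1,Y_2,Y_3,Z_1,Z_2$ are mutually disjoint nonempty sets. Then every extension $T'$ of $T$ is a shift of a $[2]$-trade of the same form, i.e. there is $W\subseteq V$ with $WT'=(1-Y'_1)(1-Y'_2)(1-Y'_3)-(1-Z'_1)(1-Z'_2)(1-Y'_1Y'_2Y'_3)$ for mutually disjoint nonempty sets $Y'_1,Y'_2,Y'_3,Z'_1,Z'_2$.
   Context: Let $V$ be a finite set. Subsets of $V$ form a group under symmetric difference $\oplus$, and we work in the group ring $\mathbb Z[(2^V,\oplus)]$: juxtaposition $XY$ of sets denotes $X\oplus Y$, $1$ denotes the empty set, and $x_i=\{i\}$. A pair $T=(T_+,T_-)$ of disjoint finite multisets of subsets (blocks) is identified with $\sum_X\tau_X X$, where $\tau_X$ is the multiplicity of $X$ in $T_+$, or minus its multiplicity in $T_-$. $T$ is a $[t]$-trade if for each $i\le t$ every $i$-subset of $V$ lies in equally many blocks of $T_+$ as of $T_-$; its volume is $|T_+|=|T_-|$. The $Y$-shift of $T$ is $YT$. If $T'=P+x_sP'$ with $s$ not occurring in blocks of $P,P'$, its $s$-projection is $P+P'$; $T'$ is an extension of a $[t]$-trade $T$ if $T'$ is a $[t]$-trade, $T$ is the $s$-projection of $T'$ for some $s$ not in any block of $T$, and $\mathrm{vol}(T')=\mathrm{vol}(T)$.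 -}

module Defs where

open import Data.Bool using (Bool; true; false; if_then_else_; _xor_)
open import Data.Nat as ℕ using (ℕ; _≤_)
open import Data.Integer as ℤ using (ℤ; +_; -[1+_]; 0ℤ; 1ℤ)
open import Data.Fin using (Fin)
open import Data.Fin.Subset using (Subset; inside; outside; ⊥; ⁅_⁆; _∈_; _∉_; _⊆_; _∩_; ∣_∣; Nonempty)
open import Data.Fin.Subset.Properties using (_⊆?_; _∈?_)
open import Data.Vec using (Vec; []; _∷_; zipWith)
open import Data.List using (List; []; _∷_; map; _++_; foldr)
import Data.Nat.ListAction as ℕL
open import Data.Product using (Σ; ∃; _×_; _,_)
open import Data.Vec.Properties using (≡-dec)
open import Data.Bool.Properties using () renaming (_≟_ to _≟B_)
open import Relation.Nullary.Decidable using (⌊_⌋)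
open import Relation.Binary.PropositionalEquality using (_≡_)

-- V = Fin n ; subsets of V are Subset n.
-- Symmetric difference (the group operation of 2^V).
_⊕_ : ∀ {n} → Subset n → Subset n → Subset n
_⊕_ = zipWith _xor_

allSubsets : ∀ n → List (Subset n)
allSubsets ℕ.zero = [] ∷ []
allSubsets (ℕ.suc n) = map (outside ∷_) (allSubsets n) ++ map (inside ∷_) (allSubsets n)

Σ⊆ : ∀ {n} → (Subset n → ℤ) → ℤ
Σ⊆ {n} f = foldr ℤ._+_ 0ℤ (map f (allSubsets n))

Σ⊆ℕ : ∀ {n} → (Subset n → ℕ) → ℕ
Σ⊆ℕ {n} f = ℕL.sum (map f (allSubsets n))

-- Elements of the group ring ℤ[(2^V, ⊕)] : coefficient functions τ (τ X = τ_X)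
GR : ℕ → Set
GR n = Subset n → ℤ

⟦_⟧ : ∀ {n} → Subset n → GR n
⟦ X ⟧ Y = if ⌊ ≡-dec _≟B_ Y X ⌋ then 1ℤ else 0ℤ

𝟙 : ∀ {n} → GR n
𝟙 = ⟦ ⊥ ⟧

infixl 6 _+ᴳ_ _-ᴳ_
infixl 7 _*ᴳ_

_+ᴳ_ : ∀ {n} → GR n → GR n → GR n
(f +ᴳ g) X = f X ℤ.+ g X

_-ᴳ_ : ∀ {n} → GR n → GR n → GR n
(f -ᴳ g) X = f X ℤ.- g X

_*ᴳ_ : ∀ {n} → GR n → GR n → GR n
(f *ᴳ g) X = Σ⊆ (λ A → f A ℤ.* g (A ⊕ X))

_≈ᴳ_ : ∀ {n} → GR n → GR n → Set
f ≈ᴳ g = ∀ X → f X ≡ g X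

-- positive / negative parts: multiplicity of X in T₊ and in T₋
pos : ℤ → ℕ
pos (+ k) = k
pos -[1+ k ] = 0

neg : ℤ → ℕ
neg z = pos (ℤ.- z)

-- number of blocks of T₊ (resp. T₋) containing A
count₊ : ∀ {n} → GR n → Subset n → ℕ
count₊ T A = Σ⊆ℕ (λ X → if ⌊ A ⊆? X ⌋ then pos (T X) else 0)

count₋ : ∀ {n} → GR n → Subset n → ℕ
count₋ T A = Σ⊆ℕ (λ X → if ⌊ A ⊆? X ⌋ then neg (T X) else 0)

IsTrade : ∀ {n} → ℕ → GR n → Set
IsTrade {n} t T = ∀ (i : ℕ) → i ≤ t → ∀ (A : Subset n) → ∣ A ∣ ≡ i → count₊ T A ≡ count₋ T A

vol : ∀ {n} → GR n → ℕ
vol T = Σ⊆ℕ (λ X → pos (T X))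

-- s-projection of T' = P + x_s P' is P + P'
proj : ∀ {n} → Fin n → GR n → GR n
proj s T' X = if ⌊ s ∈? X ⌋ then 0ℤ else T' X ℤ.+ T' (X ⊕ ⁅ s ⁆)

IsExtension : ∀ {n} → ℕ → GR n → GR n → Set
IsExtension {n} t T T' =
  IsTrade t T' ×
  (Σ (Fin n) λ s → (∀ X → s ∈ X → T X ≡ 0ℤ) × (T ≈ᴳ proj s T')) ×
  vol T' ≡ vol T

Disjoint : ∀ {n} → Subset n → Subset n → Set
Disjoint A B = A ∩ B ≡ ⊥

Admissible : ∀ {n} → Subset n → Subset n → Subset n → Subset n → Subset n → Set
Admissible Y₁ Y₂ Y₃ Z₁ Z₂ =
  (Nonempty Y₁ × Nonempty Y₂ × Nonempty Y₃ × Nonempty Z₁ × Nonempty Z₂) ×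
  (Disjoint Y₁ Y₂ × Disjoint Y₁ Y₃ × Disjoint Y₁ Z₁ × Disjoint Y₁ Z₂ ×
   Disjoint Y₂ Y₃ × Disjoint Y₂ Z₁ × Disjoint Y₂ Z₂ ×
   Disjoint Y₃ Z₁ × Disjoint Y₃ Z₂ × Disjoint Z₁ Z₂)

form : ∀ {n} → Subset n → Subset n → Subset n → Subset n → Subset n → GR n
form Y₁ Y₂ Y₃ Z₁ Z₂ =
  (𝟙 -ᴳ ⟦ Y₁ ⟧) *ᴳ (𝟙 -ᴳ ⟦ Y₂ ⟧) *ᴳ (𝟙 -ᴳ ⟦ Y₃ ⟧)
  -ᴳ (𝟙 -ᴳ ⟦ Z₁ ⟧) *ᴳ (𝟙 -ᴳ ⟦ Z₂ ⟧) *ᴳ (𝟙 -ᴳ ⟦ Y₁ ⊕ (Y₂ ⊕ Y₃) ⟧)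

-- Let s be the new point of the extension.  The sets Y₁, Y₂, Y₃, Z₁, Z₂ and {s} are pairwise
-- disjoint (s lies in no block of T, while T(Yᵢ) and T(Zᵢ) are ±1), so they span a copy of
-- (2⁶, ⊕) inside 2^V on whose 5-dimensional part T lives.  Since T′ has the volume of T, the
-- projection T′ = P + x_s P′ ↦ P + P′ = T involves no cancellation: every block of T is a
-- block of T′ either as it is or with s adjoined, and T′ lives on the same span.  The
-- [2]-trade conditions of T′ on the sets {s, y}, y = s or y a point of one of the five sets,
-- leave few of the 2¹² ways of distributing the twelve blocks of T, and an exhaustive
-- computation in these coordinates shows each of them to be, up to the shift by {s}, the
-- form with s adjoined to at most one of the five sets.

module Submission where

open import Defs
open import Algebra.Structures using (IsCommutativeMonoid)
open import Data.Bool using (Bool; true; false; if_then_else_; _∧_; _∨_; _xor_)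
import Data.Bool.Properties as Boolₚ
open import Data.Empty using (⊥-elim)
open import Data.Fin using (Fin; zero; suc; #_)
import Data.Fin.Properties as Finₚ
open import Data.Fin.Subset using (Subset; ⁅_⁆; _∪_; _∩_; _∈_; _∉_; ∣_∣; Nonempty) renaming (⊥ to ∅)
import Data.Fin.Subset.Properties as Subsetₚ
open Subsetₚ using (nonempty?)
open import Data.Integer as ℤ using (ℤ; +_; -[1+_]; 0ℤ; 1ℤ; -1ℤ)
import Data.Integer.Properties as ℤₚ
open import Data.List as List using (List; []; _∷_; _++_; foldr)
import Data.List.Properties as Listₚ
open import Data.List.Membership.Propositional as List using ()
import Data.List.Membership.Propositional.Properties as Listₚ
open import Data.List.Relation.Unary.All as ListAll using (all?)
open import Data.List.Relation.Unary.Any as Any using (Any; any?; here; there)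
open import Data.Maybe using (Maybe; just; nothing)
open import Data.Nat as ℕ using (ℕ; z≤n; s≤s)
import Data.Nat.Properties as ℕₚ
open import Data.Product using (Σ; ∃; _×_; _,_; proj₁; proj₂)
open import Data.Sum using (_⊎_; inj₁; inj₂; [_,_]′)
open import Data.Unit using (⊤; tt)
open import Data.Vec as Vec using (Vec; []; _∷_; lookup; tabulate)
open import Data.Vec.Properties as Vecₚ using (zipWith-assoc; zipWith-comm; zipWith-identityˡ; zipWith-identityʳ)
open import Data.Vec.Relation.Unary.All as All using (All; []; _∷_)
import Data.Vec.Relation.Unary.All.Properties as Allₚ
open import Data.Vec.Relation.Unary.AllPairs using (AllPairs; []; _∷_)
open import Function using (_∘_)
open import Relation.Binary.Definitions using (DecidableEquality)
open import Relation.Binary.PropositionalEquality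
open import Relation.Nullary using (Dec; does; yes; no; ¬_; contradiction; _×-dec_; _⊎-dec_; _→-dec_)
open import Relation.Nullary.Decidable using (⌊_⌋; True; isYes≗does; dec-true; dec-false; toWitness)

⌊⌋-true : ∀ {P : Set} (P? : Dec P) → P → ⌊ P? ⌋ ≡ true
⌊⌋-true P? p = trans (isYes≗does P?) (dec-true P? p)

⌊⌋-false : ∀ {P : Set} (P? : Dec P) → ¬ P → ⌊ P? ⌋ ≡ false
⌊⌋-false P? ¬p = trans (isYes≗does P?) (dec-false P? ¬p)

infix 4 _≟ˢ_
_≟ˢ_ : ∀ {n} → DecidableEquality (Subset n)
_≟ˢ_ = Vecₚ.≡-dec Boolₚ._≟_

-- Symmetric difference

⊕-assoc : ∀ {n} (A B C : Subset n) → (A ⊕ B) ⊕ C ≡ A ⊕ (B ⊕ C)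
⊕-assoc = zipWith-assoc Boolₚ.xor-assoc

⊕-comm : ∀ {n} (A B : Subset n) → A ⊕ B ≡ B ⊕ A
⊕-comm = zipWith-comm Boolₚ.xor-comm

⊕-identityˡ : ∀ {n} (A : Subset n) → ∅ ⊕ A ≡ A
⊕-identityˡ = zipWith-identityˡ Boolₚ.xor-identityˡ

⊕-identityʳ : ∀ {n} (A : Subset n) → A ⊕ ∅ ≡ A
⊕-identityʳ = zipWith-identityʳ Boolₚ.xor-identityʳ

⊕-self : ∀ {n} (A : Subset n) → A ⊕ A ≡ ∅
⊕-self []      = refl
⊕-self (x ∷ A) = cong₂ _∷_ (Boolₚ.xor-same x) (⊕-self A)

⊕-cancelʳ : ∀ {n} (A B : Subset n) → (A ⊕ B) ⊕ B ≡ A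
⊕-cancelʳ A B = begin
  (A ⊕ B) ⊕ B  ≡⟨ ⊕-assoc A B B ⟩
  A ⊕ (B ⊕ B)  ≡⟨ cong (A ⊕_) (⊕-self B) ⟩
  A ⊕ ∅        ≡⟨ ⊕-identityʳ A ⟩
  A            ∎
  where open ≡-Reasoning

⊕-cancelˡ : ∀ {n} (A B : Subset n) → A ⊕ (A ⊕ B) ≡ B
⊕-cancelˡ A B = trans (sym (⊕-assoc A A B)) (trans (cong (_⊕ B) (⊕-self A)) (⊕-identityˡ B))

lookup-⊕ : ∀ {n} (A B : Subset n) i → lookup (A ⊕ B) i ≡ lookup A i xor lookup B i
lookup-⊕ A B i = Vecₚ.lookup-zipWith _xor_ i A B

lookup-∩ : ∀ {n} (A B : Subset n) i → lookup (A ∩ B) i ≡ lookup A i ∧ lookup B i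
lookup-∩ A B i = Vecₚ.lookup-zipWith _∧_ i A B

lookup-∅ : ∀ {n} (i : Fin n) → lookup ∅ i ≡ false
lookup-∅ i = Vecₚ.lookup-replicate i false


lookup-ext : ∀ {n} {A B : Subset n} → (∀ i → lookup A i ≡ lookup B i) → A ≡ B
lookup-ext {A = A} {B} h =
  trans (sym (Vecₚ.tabulate∘lookup A)) (trans (Vecₚ.tabulate-cong h) (Vecₚ.tabulate∘lookup B))

∈⇒lookup : ∀ {n} {x : Fin n} {A} → x ∈ A → lookup A x ≡ true
∈⇒lookup = Vecₚ.[]=⇒lookup

lookup⇒∈ : ∀ {n} {x : Fin n} {A} → lookup A x ≡ true → x ∈ A
lookup⇒∈ {x = x} {A} = Vecₚ.lookup⇒[]= x A

∉⇒lookup : ∀ {n} {x : Fin n} {A} → x ∉ A → lookup A x ≡ false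
∉⇒lookup {x = x} {A} x∉A with lookup A x in eq
... | true  = contradiction (lookup⇒∈ eq) x∉A
... | false = refl

⌊∈?⌋ : ∀ {n} (x : Fin n) A → ⌊ x Subsetₚ.∈? A ⌋ ≡ lookup A x
⌊∈?⌋ x A with x Subsetₚ.∈? A
... | yes x∈A = sym (∈⇒lookup x∈A)
... | no  x∉A = sym (∉⇒lookup x∉A)

⌊⊆?⌋-⁅⁆∪⁅⁆ : ∀ {n} (x y : Fin n) X → ⌊ ⁅ x ⁆ ∪ ⁅ y ⁆ Subsetₚ.⊆? X ⌋ ≡ lookup X x ∧ lookup X y
⌊⊆?⌋-⁅⁆∪⁅⁆ x y X with ⁅ x ⁆ ∪ ⁅ y ⁆ Subsetₚ.⊆? X
... | yes ⊆X = sym (cong₂ _∧_ (∈⇒lookup (⊆X (Subsetₚ.x∈p∪q⁺ (inj₁ (Subsetₚ.x∈⁅x⁆ x)))))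
                              (∈⇒lookup (⊆X (Subsetₚ.x∈p∪q⁺ (inj₂ (Subsetₚ.x∈⁅x⁆ y))))))
... | no  ⊈X with lookup X x in ex | lookup X y in ey
...   | false | _     = refl
...   | true  | false = refl
...   | true  | true  = contradiction (λ {z} z∈ → [ from ex , from ey ]′ (Subsetₚ.x∈p∪q⁻ ⁅ x ⁆ ⁅ y ⁆ z∈)) ⊈X
  where
  from : ∀ {u z} → lookup X u ≡ true → z ∈ ⁅ u ⁆ → z ∈ X
  from {u} eq z∈⁅u⁆ rewrite Subsetₚ.x∈⁅y⁆⇒x≡y u z∈⁅u⁆ = lookup⇒∈ eq

∣p∪q∣≤∣p∣+∣q∣ : ∀ {n} (p q : Subset n) → ∣ p ∪ q ∣ ℕ.≤ ∣ p ∣ ℕ.+ ∣ q ∣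
∣p∪q∣≤∣p∣+∣q∣ []          []          = z≤n
∣p∪q∣≤∣p∣+∣q∣ (false ∷ p) (false ∷ q) = ∣p∪q∣≤∣p∣+∣q∣ p q
∣p∪q∣≤∣p∣+∣q∣ (false ∷ p) (true  ∷ q) =
  subst (ℕ.suc ∣ p ∪ q ∣ ℕ.≤_) (sym (ℕₚ.+-suc ∣ p ∣ ∣ q ∣)) (s≤s (∣p∪q∣≤∣p∣+∣q∣ p q))
∣p∪q∣≤∣p∣+∣q∣ (true  ∷ p) (false ∷ q) = s≤s (∣p∪q∣≤∣p∣+∣q∣ p q)
∣p∪q∣≤∣p∣+∣q∣ (true  ∷ p) (true  ∷ q) =
  s≤s (ℕₚ.≤-trans (∣p∪q∣≤∣p∣+∣q∣ p q) (ℕₚ.+-monoʳ-≤ ∣ p ∣ (ℕₚ.n≤1+n ∣ q ∣)))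

∣⁅x⁆∪⁅y⁆∣≤2 : ∀ {n} (x y : Fin n) → ∣ ⁅ x ⁆ ∪ ⁅ y ⁆ ∣ ℕ.≤ 2
∣⁅x⁆∪⁅y⁆∣≤2 x y = subst (∣ ⁅ x ⁆ ∪ ⁅ y ⁆ ∣ ℕ.≤_) (cong₂ ℕ._+_ (Subsetₚ.∣⁅x⁆∣≡1 x) (Subsetₚ.∣⁅x⁆∣≡1 y))
                         (∣p∪q∣≤∣p∣+∣q∣ ⁅ x ⁆ ⁅ y ⁆)

disjoint-lookupʳ : ∀ {n} {A B : Subset n} {x} → Disjoint A B → lookup A x ≡ true → lookup B x ≡ false
disjoint-lookupʳ {A = A} {B} {x} A∩B≡∅ x∈A = begin
  lookup B x                ≡⟨ cong (_∧ lookup B x) x∈A ⟨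
  lookup A x ∧ lookup B x   ≡⟨ lookup-∩ A B x ⟨
  lookup (A ∩ B) x          ≡⟨ cong (λ C → lookup C x) A∩B≡∅ ⟩
  lookup ∅ x                ≡⟨ lookup-∅ x ⟩
  false                     ∎
  where open ≡-Reasoning

disjoint-lookupˡ : ∀ {n} {A B : Subset n} {x} → Disjoint A B → lookup B x ≡ true → lookup A x ≡ false
disjoint-lookupˡ {A = A} {B} A∩B≡∅ = disjoint-lookupʳ (trans (Subsetₚ.∩-comm B A) A∩B≡∅)

⟦⟧-self : ∀ {n} (X : Subset n) → ⟦ X ⟧ X ≡ 1ℤ
⟦⟧-self X rewrite ⌊⌋-true (X ≟ˢ X) refl = refl

⟦⟧-other : ∀ {n} {X Y : Subset n} → Y ≢ X → ⟦ X ⟧ Y ≡ 0ℤ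
⟦⟧-other {X = X} {Y} Y≢X rewrite ⌊⌋-false (Y ≟ˢ X) Y≢X = refl

if-≟ˢ : ∀ {n} {A : Set} (f : Subset n → A) (z : A) X Y →
        (if ⌊ X ≟ˢ Y ⌋ then f X else z) ≡ (if ⌊ X ≟ˢ Y ⌋ then f Y else z)
if-≟ˢ f z X Y with X ≟ˢ Y
... | yes refl = refl
... | no  _    = refl

∈-allSubsets : ∀ {n} (X : Subset n) → X List.∈ allSubsets n
∈-allSubsets []          = here refl
∈-allSubsets {ℕ.suc n} (false ∷ X) = Listₚ.∈-++⁺ˡ (Listₚ.∈-map⁺ (false ∷_) (∈-allSubsets X))
∈-allSubsets {ℕ.suc n} (true  ∷ X) =
  Listₚ.∈-++⁺ʳ (List.map (false ∷_) (allSubsets n)) (Listₚ.∈-map⁺ (true ∷_) (∈-allSubsets X))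

-- Sums over all subsets

module CommutativeSum {A : Set} {_∙_ : A → A → A} {ε : A}
                      (isCommutativeMonoid : IsCommutativeMonoid _≡_ _∙_ ε) where

  open IsCommutativeMonoid isCommutativeMonoid using (assoc; comm; identityˡ; identityʳ)

  sumOver : ∀ {X : Set} → List X → (X → A) → A
  sumOver xs f = foldr _∙_ ε (List.map f xs)

  ∑ : ∀ {n} → (Subset n → A) → A
  ∑ {n} = sumOver (allSubsets n)

  sumOver-cong : ∀ {X : Set} {f g : X → A} → (∀ x → f x ≡ g x) → ∀ xs → sumOver xs f ≡ sumOver xs g
  sumOver-cong f≗g xs = cong (foldr _∙_ ε) (Listₚ.map-cong f≗g xs)

  ∑-cong : ∀ {n} {f g : Subset n → A} → (∀ X → f X ≡ g X) → ∑ f ≡ ∑ g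
  ∑-cong {n} f≗g = sumOver-cong f≗g (allSubsets n)

  sumOver-ε : ∀ {X : Set} (xs : List X) → sumOver xs (λ _ → ε) ≡ ε
  sumOver-ε []       = refl
  sumOver-ε (x ∷ xs) = trans (cong (ε ∙_) (sumOver-ε xs)) (identityˡ ε)

  sumOver-++ : ∀ {X : Set} (xs ys : List X) f → sumOver (xs ++ ys) f ≡ sumOver xs f ∙ sumOver ys f
  sumOver-++ []       ys f = sym (identityˡ _)
  sumOver-++ (x ∷ xs) ys f = trans (cong (f x ∙_) (sumOver-++ xs ys f)) (sym (assoc (f x) _ _))

  sumOver-map : ∀ {X Y : Set} (h : X → Y) xs f → sumOver (List.map h xs) f ≡ sumOver xs (f ∘ h)
  sumOver-map h []       f = refl
  sumOver-map h (x ∷ xs) f = cong (f (h x) ∙_) (sumOver-map h xs f)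

  ∙-interchange : ∀ a b c d → (a ∙ b) ∙ (c ∙ d) ≡ (a ∙ c) ∙ (b ∙ d)
  ∙-interchange a b c d = begin
    (a ∙ b) ∙ (c ∙ d)  ≡⟨ assoc a b (c ∙ d) ⟩
    a ∙ (b ∙ (c ∙ d))  ≡⟨ cong (a ∙_) (assoc b c d) ⟨
    a ∙ ((b ∙ c) ∙ d)  ≡⟨ cong (λ u → a ∙ (u ∙ d)) (comm b c) ⟩
    a ∙ ((c ∙ b) ∙ d)  ≡⟨ cong (a ∙_) (assoc c b d) ⟩
    a ∙ (c ∙ (b ∙ d))  ≡⟨ assoc a c (b ∙ d) ⟨
    (a ∙ c) ∙ (b ∙ d)  ∎
    where open ≡-Reasoning

  sumOver-∙ : ∀ {X : Set} (xs : List X) f g → sumOver xs (λ x → f x ∙ g x) ≡ sumOver xs f ∙ sumOver xs g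
  sumOver-∙ []       f g = sym (identityˡ ε)
  sumOver-∙ (x ∷ xs) f g = trans (cong ((f x ∙ g x) ∙_) (sumOver-∙ xs f g)) (∙-interchange _ _ _ _)

  sumOver-swap : ∀ {X Y : Set} (xs : List X) (ys : List Y) (h : X → Y → A) →
                 sumOver xs (λ x → sumOver ys (h x)) ≡ sumOver ys (λ y → sumOver xs (λ x → h x y))
  sumOver-swap []       ys h = sym (sumOver-ε ys)
  sumOver-swap (x ∷ xs) ys h = trans (cong (sumOver ys (h x) ∙_) (sumOver-swap xs ys h))
                                     (sym (sumOver-∙ ys (h x) (λ y → sumOver xs (λ x → h x y))))

  ∑-split : ∀ {n} (f : Subset (ℕ.suc n) → A) → ∑ f ≡ ∑ (λ X → f (false ∷ X)) ∙ ∑ (λ X → f (true ∷ X))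
  ∑-split {n} f = trans (sumOver-++ (List.map (false ∷_) (allSubsets n)) _ f)
                        (cong₂ _∙_ (sumOver-map (false ∷_) (allSubsets n) f)
                                   (sumOver-map (true ∷_) (allSubsets n) f))

  -- Stated with does rather than ⌊_⌋: only the former reduces on x ∷ xs ≟ˢ y ∷ ys.
  ∑-delta′ : ∀ {n} (C : Subset n) (v : A) → ∑ (λ X → if does (X ≟ˢ C) then v else ε) ≡ v
  ∑-delta′ []          v = identityʳ v
  ∑-delta′ {ℕ.suc n} (false ∷ C) v = begin
    ∑ (λ X → if does (X ≟ˢ false ∷ C) then v else ε)
      ≡⟨ ∑-split (λ X → if does (X ≟ˢ false ∷ C) then v else ε) ⟩
    ∑ (λ X → if does (X ≟ˢ C) then v else ε) ∙ ∑ {n} (λ _ → ε)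
      ≡⟨ cong₂ _∙_ (∑-delta′ C v) (sumOver-ε (allSubsets n)) ⟩
    v ∙ ε
      ≡⟨ identityʳ v ⟩
    v ∎
    where open ≡-Reasoning
  ∑-delta′ {ℕ.suc n} (true ∷ C) v = begin
    ∑ (λ X → if does (X ≟ˢ true ∷ C) then v else ε)
      ≡⟨ ∑-split (λ X → if does (X ≟ˢ true ∷ C) then v else ε) ⟩
    ∑ {n} (λ _ → ε) ∙ ∑ (λ X → if does (X ≟ˢ C) then v else ε)
      ≡⟨ cong₂ _∙_ (sumOver-ε (allSubsets n)) (∑-delta′ C v) ⟩
    ε ∙ v
      ≡⟨ identityˡ v ⟩
    v ∎
    where open ≡-Reasoning

  ∑-delta : ∀ {n} (C : Subset n) (v : A) → ∑ (λ X → if ⌊ X ≟ˢ C ⌋ then v else ε) ≡ v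
  ∑-delta C v = trans (∑-cong (λ X → cong (if_then v else ε) (isYes≗does (X ≟ˢ C)))) (∑-delta′ C v)

  ∑-pairs : ∀ {n} (s : Fin n) (f : Subset n → A) →
            ∑ f ≡ ∑ (λ X → if lookup X s then ε else f X ∙ f (X ⊕ ⁅ s ⁆))
  ∑-pairs {ℕ.suc n} zero f = begin
    ∑ f                                               ≡⟨ ∑-split f ⟩
    ∑ (λ X → f (false ∷ X)) ∙ ∑ (λ X → f (true ∷ X))  ≡⟨ sumOver-∙ (allSubsets n) _ _ ⟨
    ∑ (λ X → f (false ∷ X) ∙ f (true ∷ X))            ≡⟨ ∑-cong (λ X → cong (pair′ X) (sym (⊕-identityʳ X))) ⟩
    ∑ pair                                            ≡⟨ identityʳ _ ⟨
    ∑ pair ∙ ε                                        ≡⟨ cong (∑ pair ∙_) (sumOver-ε (allSubsets n)) ⟨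
    ∑ pair ∙ ∑ {n} (λ _ → ε)
      ≡⟨ ∑-split (λ X → if lookup X zero then ε else f X ∙ f (X ⊕ ⁅ zero ⁆)) ⟨
    ∑ (λ X → if lookup X zero then ε else f X ∙ f (X ⊕ ⁅ zero ⁆)) ∎
    where
    open ≡-Reasoning
    pair′ : Subset n → Subset n → A
    pair′ X Y = f (false ∷ X) ∙ f (true ∷ Y)
    pair : Subset n → A
    pair X = pair′ X (X ⊕ ∅)
  ∑-pairs {ℕ.suc n} (suc s) f = begin
    ∑ f                                                        ≡⟨ ∑-split f ⟩
    ∑ (λ X → f (false ∷ X)) ∙ ∑ (λ X → f (true ∷ X))           ≡⟨ cong₂ _∙_ (∑-pairs s _) (∑-pairs s _) ⟩
    _ ∙ _
      ≡⟨ ∑-split (λ X → if lookup X (suc s) then ε else f X ∙ f (X ⊕ ⁅ suc s ⁆)) ⟨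
    ∑ (λ X → if lookup X (suc s) then ε else f X ∙ f (X ⊕ ⁅ suc s ⁆)) ∎
    where open ≡-Reasoning

module ℤSum = CommutativeSum ℤₚ.+-0-isCommutativeMonoid
module ℕSum = CommutativeSum ℕₚ.+-0-isCommutativeMonoid

-- Multiplying by 1 − B in the group ring

sumOver-neg : ∀ {X : Set} (xs : List X) (f : X → ℤ) →
              ℤSum.sumOver xs (λ x → ℤ.- f x) ≡ ℤ.- ℤSum.sumOver xs f
sumOver-neg []       f = refl
sumOver-neg (x ∷ xs) f =
  trans (cong (λ y → ℤ.- f x ℤ.+ y) (sumOver-neg xs f)) (sym (ℤₚ.neg-distrib-+ (f x) _))

infixl 7 _·⟨1−_⟩

_·⟨1−_⟩ : ∀ {n} → GR n → Subset n → GR n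
(f ·⟨1− B ⟩) X = f X ℤ.- f (B ⊕ X)

⟦⟧-*ᴳ : ∀ {n} (W : Subset n) (g : GR n) X → (⟦ W ⟧ *ᴳ g) X ≡ g (W ⊕ X)
⟦⟧-*ᴳ W g X = trans (ℤSum.∑-cong term) (ℤSum.∑-delta W (g (W ⊕ X)))
  where
  term : ∀ A → ⟦ W ⟧ A ℤ.* g (A ⊕ X) ≡ (if ⌊ A ≟ˢ W ⌋ then g (W ⊕ X) else 0ℤ)
  term A with A ≟ˢ W
  ... | yes refl = ℤₚ.*-identityˡ _
  ... | no  _    = ℤₚ.*-zeroˡ (g (A ⊕ X))

*ᴳ-⟦⟧ : ∀ {n} (f : GR n) (C : Subset n) X → (f *ᴳ ⟦ C ⟧) X ≡ f (C ⊕ X)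
*ᴳ-⟦⟧ f C X = trans (ℤSum.∑-cong term) (ℤSum.∑-delta (C ⊕ X) (f (C ⊕ X)))
  where
  term : ∀ A → f A ℤ.* ⟦ C ⟧ (A ⊕ X) ≡ (if ⌊ A ≟ˢ C ⊕ X ⌋ then f (C ⊕ X) else 0ℤ)
  term A with A ≟ˢ C ⊕ X
  ... | yes refl rewrite ⊕-cancelʳ C X | ⟦⟧-self C = ℤₚ.*-identityʳ _
  ... | no  A≢C⊕X = trans (cong (f A ℤ.*_) (⟦⟧-other A⊕X≢C)) (ℤₚ.*-zeroʳ (f A))
    where
    A⊕X≢C : A ⊕ X ≢ C
    A⊕X≢C A⊕X≡C = A≢C⊕X (trans (sym (⊕-cancelʳ A X)) (cong (_⊕ X) A⊕X≡C))

*ᴳ-1−⟦⟧ : ∀ {n} (f : GR n) (B : Subset n) → (f *ᴳ (𝟙 -ᴳ ⟦ B ⟧)) ≈ᴳ (f ·⟨1− B ⟩)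
*ᴳ-1−⟦⟧ {n} f B X = begin
  (f *ᴳ (𝟙 -ᴳ ⟦ B ⟧)) X
    ≡⟨ ℤSum.∑-cong distrib ⟩
  ℤSum.∑ (λ A → f A ℤ.* ⟦ ∅ ⟧ (A ⊕ X) ℤ.+ ℤ.- (f A ℤ.* ⟦ B ⟧ (A ⊕ X)))
    ≡⟨ ℤSum.sumOver-∙ (allSubsets n) _ _ ⟩
  (f *ᴳ 𝟙) X ℤ.+ ℤSum.∑ (λ A → ℤ.- (f A ℤ.* ⟦ B ⟧ (A ⊕ X)))
    ≡⟨ cong₂ ℤ._+_ (*ᴳ-⟦⟧ f ∅ X) (sumOver-neg (allSubsets n) _) ⟩
  f (∅ ⊕ X) ℤ.- (f *ᴳ ⟦ B ⟧) X
    ≡⟨ cong₂ ℤ._-_ (cong f (⊕-identityˡ X)) (*ᴳ-⟦⟧ f B X) ⟩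
  f X ℤ.- f (B ⊕ X)
    ∎
  where
  open ≡-Reasoning
  distrib : ∀ A → f A ℤ.* (𝟙 -ᴳ ⟦ B ⟧) (A ⊕ X) ≡ f A ℤ.* ⟦ ∅ ⟧ (A ⊕ X) ℤ.+ ℤ.- (f A ℤ.* ⟦ B ⟧ (A ⊕ X))
  distrib A = trans (ℤₚ.*-distribˡ-+ (f A) _ _)
                    (cong (λ y → f A ℤ.* ⟦ ∅ ⟧ (A ⊕ X) ℤ.+ y) (sym (ℤₚ.neg-distribʳ-* (f A) _)))

·⟨1−⟩-congˡ : ∀ {n} {f g : GR n} (B : Subset n) → f ≈ᴳ g → (f ·⟨1− B ⟩) ≈ᴳ (g ·⟨1− B ⟩)
·⟨1−⟩-congˡ B f≈g X = cong₂ ℤ._-_ (f≈g X) (f≈g (B ⊕ X))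

-ᴳ-cong : ∀ {n} {f f′ g g′ : GR n} → f ≈ᴳ f′ → g ≈ᴳ g′ → (f -ᴳ g) ≈ᴳ (f′ -ᴳ g′)
-ᴳ-cong f≈f′ g≈g′ X = cong₂ ℤ._-_ (f≈f′ X) (g≈g′ X)

form′ : ∀ {n} → Subset n → Subset n → Subset n → Subset n → Subset n → GR n
form′ Y₁ Y₂ Y₃ Z₁ Z₂ =
  (𝟙 -ᴳ ⟦ Y₁ ⟧) ·⟨1− Y₂ ⟩ ·⟨1− Y₃ ⟩ -ᴳ (𝟙 -ᴳ ⟦ Z₁ ⟧) ·⟨1− Z₂ ⟩ ·⟨1− Y₁ ⊕ (Y₂ ⊕ Y₃) ⟩

form≈form′ : ∀ {n} (Y₁ Y₂ Y₃ Z₁ Z₂ : Subset n) → form Y₁ Y₂ Y₃ Z₁ Z₂ ≈ᴳ form′ Y₁ Y₂ Y₃ Z₁ Z₂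
form≈form′ Y₁ Y₂ Y₃ Z₁ Z₂ = -ᴳ-cong (twice (𝟙 -ᴳ ⟦ Y₁ ⟧) Y₂ Y₃) (twice (𝟙 -ᴳ ⟦ Z₁ ⟧) Z₂ (Y₁ ⊕ (Y₂ ⊕ Y₃)))
  where
  twice : ∀ f B C → (f *ᴳ (𝟙 -ᴳ ⟦ B ⟧) *ᴳ (𝟙 -ᴳ ⟦ C ⟧)) ≈ᴳ (f ·⟨1− B ⟩ ·⟨1− C ⟩)
  twice f B C X = trans (*ᴳ-1−⟦⟧ (f *ᴳ (𝟙 -ᴳ ⟦ B ⟧)) C X) (·⟨1−⟩-congˡ C (*ᴳ-1−⟦⟧ f B) X)

-- Coordinates on the span of pairwise disjoint sets

xor-interchange : ∀ a b c d → (a xor b) xor (c xor d) ≡ (a xor c) xor (b xor d)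
xor-interchange false false c d = refl
xor-interchange false true  c d = Boolₚ.not-distribʳ-xor c d
xor-interchange true  false c d = Boolₚ.not-distribˡ-xor c d
xor-interchange true  true  c d = sym (Boolₚ.xor-annihilates-not c d)

dot : ∀ {m} → Subset m → Subset m → Bool
dot []       []       = false
dot (a ∷ as) (g ∷ gs) = (a ∧ g) xor dot as gs

dot-∅ˡ : ∀ {m} (g : Subset m) → dot ∅ g ≡ false
dot-∅ˡ []       = refl
dot-∅ˡ (g ∷ gs) = dot-∅ˡ gs

dot-∅ʳ : ∀ {m} (a : Subset m) → dot a ∅ ≡ false
dot-∅ʳ []       = refl
dot-∅ʳ (a ∷ as) rewrite Boolₚ.∧-zeroʳ a = dot-∅ʳ as

dot-⁅⁆ˡ : ∀ {m} (g : Subset m) k → dot ⁅ k ⁆ g ≡ lookup g k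
dot-⁅⁆ˡ (g ∷ gs) zero    rewrite dot-∅ˡ gs = Boolₚ.xor-identityʳ g
dot-⁅⁆ˡ (g ∷ gs) (suc k) = dot-⁅⁆ˡ gs k

dot-⁅⁆ʳ : ∀ {m} (a : Subset m) k → dot a ⁅ k ⁆ ≡ lookup a k
dot-⁅⁆ʳ (a ∷ as) zero    rewrite Boolₚ.∧-identityʳ a | dot-∅ʳ as = Boolₚ.xor-identityʳ a
dot-⁅⁆ʳ (a ∷ as) (suc k) rewrite Boolₚ.∧-zeroʳ a = dot-⁅⁆ʳ as k

dot-⊕ˡ : ∀ {m} (a b g : Subset m) → dot (a ⊕ b) g ≡ dot a g xor dot b g
dot-⊕ˡ []      []      []      = refl
dot-⊕ˡ (x ∷ a) (y ∷ b) (h ∷ g) rewrite Boolₚ.∧-distribʳ-xor h x y | dot-⊕ˡ a b g =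
  xor-interchange (x ∧ h) (y ∧ h) (dot a g) (dot b g)

AtMostOne : ∀ {m} → Subset m → Set
AtMostOne []          = ⊤
AtMostOne (false ∷ g) = AtMostOne g
AtMostOne (true  ∷ g) = g ≡ ∅

dot-disjoint : ∀ {m} (a b g : Subset m) → AtMostOne g → Disjoint a b → dot a g ∧ dot b g ≡ false
dot-disjoint []      []      []          _   _ = refl
dot-disjoint (x ∷ a) (y ∷ b) (false ∷ g) amo a∩b≡∅ rewrite Boolₚ.∧-zeroʳ x | Boolₚ.∧-zeroʳ y =
  dot-disjoint a b g amo (Vecₚ.∷-injectiveʳ a∩b≡∅)
dot-disjoint (x ∷ a) (y ∷ b) (true ∷ g) refl a∩b≡∅
  rewrite Boolₚ.∧-identityʳ x | Boolₚ.∧-identityʳ y | dot-∅ʳ a | dot-∅ʳ b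
        | Boolₚ.xor-identityʳ x | Boolₚ.xor-identityʳ y = Vecₚ.∷-injectiveˡ a∩b≡∅

column : ∀ {n m} → Vec (Subset n) m → Fin n → Subset m
column gens i = Vec.map (λ G → lookup G i) gens

column-∅ : ∀ {n m} {gens : Vec (Subset n) m} {i} → All (λ G → lookup G i ≡ false) gens → column gens i ≡ ∅
column-∅ []         = refl
column-∅ (i∉G ∷ i∉) = cong₂ _∷_ i∉G (column-∅ i∉)

column-atMostOne : ∀ {n m} {gens : Vec (Subset n) m} → AllPairs Disjoint gens → ∀ i → AtMostOne (column gens i)
column-atMostOne {gens = []}     []                 i = tt
column-atMostOne {gens = G ∷ gens} (disjG ∷ disjoint) i with lookup G i in i∈G
... | true  = column-∅ (All.map (λ G∩G′≡∅ → disjoint-lookupʳ G∩G′≡∅ i∈G) disjG)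
... | false = column-atMostOne disjoint i

column-pt : ∀ {n m} {gens : Vec (Subset n) m} (pt : Fin m → Fin n) → AllPairs Disjoint gens →
            (∀ k → pt k ∈ lookup gens k) → ∀ k → column gens (pt k) ≡ ⁅ k ⁆
column-pt {gens = G ∷ gens} pt (disjG ∷ disjoint) pt∈ zero =
  cong₂ _∷_ (∈⇒lookup (pt∈ zero))
            (column-∅ (All.map (λ G∩G′≡∅ → disjoint-lookupʳ G∩G′≡∅ (∈⇒lookup (pt∈ zero))) disjG))
column-pt {gens = G ∷ gens} pt (disjG ∷ disjoint) pt∈ (suc k) =
  cong₂ _∷_ (disjoint-lookupˡ (Allₚ.lookup⁺ disjG k) (∈⇒lookup (pt∈ (suc k))))
            (column-pt (pt ∘ suc) disjoint (pt∈ ∘ suc) k)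

⁅x⁆-disjoint : ∀ {n} {x : Fin n} {A} → lookup A x ≡ false → Disjoint ⁅ x ⁆ A
⁅x⁆-disjoint {x = x} {A} x∉A = lookup-ext λ i → trans (lookup-∩ ⁅ x ⁆ A i) (trans (at i) (sym (lookup-∅ i)))
  where
  at : ∀ i → lookup ⁅ x ⁆ i ∧ lookup A i ≡ false
  at i with lookup ⁅ x ⁆ i in i∈⁅x⁆
  ... | false = refl
  ... | true rewrite Subsetₚ.x∈⁅y⁆⇒x≡y x (lookup⇒∈ i∈⁅x⁆) = x∉A

admissible-nonempty : ∀ {n} {Y₁ Y₂ Y₃ Z₁ Z₂ : Subset n} → Admissible Y₁ Y₂ Y₃ Z₁ Z₂ →
                      All Nonempty (Y₁ ∷ Y₂ ∷ Y₃ ∷ Z₁ ∷ Z₂ ∷ [])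
admissible-nonempty ((n₁ , n₂ , n₃ , n₄ , n₅) , _) = n₁ ∷ n₂ ∷ n₃ ∷ n₄ ∷ n₅ ∷ []

admissible-disjoint : ∀ {n} {Y₁ Y₂ Y₃ Z₁ Z₂ : Subset n} → Admissible Y₁ Y₂ Y₃ Z₁ Z₂ →
                      AllPairs Disjoint (Y₁ ∷ Y₂ ∷ Y₃ ∷ Z₁ ∷ Z₂ ∷ [])
admissible-disjoint (_ , (d₁₂ , d₁₃ , d₁₄ , d₁₅ , d₂₃ , d₂₄ , d₂₅ , d₃₄ , d₃₅ , d₄₅)) =
  (d₁₂ ∷ d₁₃ ∷ d₁₄ ∷ d₁₅ ∷ []) ∷ (d₂₃ ∷ d₂₄ ∷ d₂₅ ∷ []) ∷ (d₃₄ ∷ d₃₅ ∷ []) ∷ (d₄₅ ∷ []) ∷ [] ∷ []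

-- For pairwise disjoint gens with points pt k ∈ gens k, emb c = ⊕_{k ∈ c} gens k embeds
-- (2^m, ⊕) into (2^n, ⊕), coords reads c back off the points, and lift φ extends φ by zero.
module Coordinates {n m} (gens : Vec (Subset n) m) (pt : Fin m → Fin n)
                   (gens-disjoint : AllPairs Disjoint gens) (pt∈gen : ∀ k → pt k ∈ lookup gens k) where

  emb : Subset m → Subset n
  emb a = tabulate (λ i → dot a (column gens i))

  coords : Subset n → Subset m
  coords X = tabulate (λ k → lookup X (pt k))

  lookup-emb : ∀ a i → lookup (emb a) i ≡ dot a (column gens i)
  lookup-emb a = Vecₚ.lookup∘tabulate _

  lookup-emb-pt : ∀ a k → lookup (emb a) (pt k) ≡ lookup a k
  lookup-emb-pt a k = trans (lookup-emb a (pt k))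
                            (trans (cong (dot a) (column-pt pt gens-disjoint pt∈gen k)) (dot-⁅⁆ʳ a k))

  coords-emb : ∀ a → coords (emb a) ≡ a
  coords-emb a = lookup-ext λ k → trans (Vecₚ.lookup∘tabulate _ k) (lookup-emb-pt a k)

  emb-injective : ∀ {a b} → emb a ≡ emb b → a ≡ b
  emb-injective {a} {b} eq = trans (sym (coords-emb a)) (trans (cong coords eq) (coords-emb b))

  emb-⊕ : ∀ a b → emb (a ⊕ b) ≡ emb a ⊕ emb b
  emb-⊕ a b = lookup-ext λ i → begin
    lookup (emb (a ⊕ b)) i                          ≡⟨ lookup-emb (a ⊕ b) i ⟩
    dot (a ⊕ b) (column gens i)                     ≡⟨ dot-⊕ˡ a b _ ⟩
    dot a (column gens i) xor dot b (column gens i) ≡⟨ cong₂ _xor_ (lookup-emb a i) (lookup-emb b i) ⟨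
    lookup (emb a) i xor lookup (emb b) i           ≡⟨ lookup-⊕ (emb a) (emb b) i ⟨
    lookup (emb a ⊕ emb b) i                        ∎
    where open ≡-Reasoning

  emb-⁅⁆ : ∀ k → emb ⁅ k ⁆ ≡ lookup gens k
  emb-⁅⁆ k = lookup-ext λ i →
    trans (lookup-emb ⁅ k ⁆ i) (trans (dot-⁅⁆ˡ (column gens i) k) (Vecₚ.lookup-map k (λ G → lookup G i) gens))

  emb-∅ : emb ∅ ≡ ∅
  emb-∅ = lookup-ext λ i → trans (lookup-emb ∅ i) (trans (dot-∅ˡ (column gens i)) (sym (lookup-∅ i)))

  image? : ∀ X → (∃ λ c → X ≡ emb c) ⊎ (∀ c → X ≢ emb c)
  image? X with X ≟ˢ emb (coords X)
  ... | yes X≡ = inj₁ (coords X , X≡)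
  ... | no  X≢ = inj₂ λ c X≡emb-c →
    X≢ (trans X≡emb-c (cong emb (sym (trans (cong coords X≡emb-c) (coords-emb c)))))

  lift : (Subset m → ℤ) → GR n
  lift φ X with image? X
  ... | inj₁ (c , _) = φ c
  ... | inj₂ _       = 0ℤ

  lift-emb : ∀ φ c → lift φ (emb c) ≡ φ c
  lift-emb φ c with image? (emb c)
  ... | inj₁ (c′ , eq) = cong φ (emb-injective (sym eq))
  ... | inj₂ ∉img   = ⊥-elim (∉img c refl)

  lift-outside : ∀ φ {X} → (∀ c → X ≢ emb c) → lift φ X ≡ 0ℤ
  lift-outside φ {X} ∉img with image? X
  ... | inj₁ (c , eq) = ⊥-elim (∉img c eq)
  ... | inj₂ _        = refl

  ≈lift : ∀ {F : GR n} φ → (∀ c → F (emb c) ≡ φ c) → (∀ X → (∀ c → X ≢ emb c) → F X ≡ 0ℤ) → F ≈ᴳ lift φ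
  ≈lift φ onImage offImage X with image? X
  ... | inj₁ (c , refl) = onImage c
  ... | inj₂ ∉img        = offImage X ∉img

  lift-cong : ∀ {φ ψ} → (∀ c → φ c ≡ ψ c) → lift φ ≈ᴳ lift ψ
  lift-cong {φ} {ψ} φ≗ψ = ≈lift ψ (λ c → trans (lift-emb φ c) (φ≗ψ c)) (λ X ∉img → lift-outside φ ∉img)

  lift-preserves : ∀ (P : ℤ → Set) {φ} → P 0ℤ → (∀ c → P (φ c)) → ∀ X → P (lift φ X)
  lift-preserves P P0 Pφ X with image? X
  ... | inj₁ (c , _) = Pφ c
  ... | inj₂ _       = P0

  ⟦emb⟧ : ∀ c → ⟦ emb c ⟧ ≈ᴳ lift ⟦ c ⟧
  ⟦emb⟧ c = ≈lift ⟦ c ⟧ onImage (λ X ∉img → ⟦⟧-other (∉img c))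
    where
    onImage : ∀ c′ → ⟦ emb c ⟧ (emb c′) ≡ ⟦ c ⟧ c′
    onImage c′ with c′ ≟ˢ c
    ... | yes refl = ⟦⟧-self (emb c)
    ... | no  c′≢c = ⟦⟧-other (c′≢c ∘ emb-injective)

  outside-⊕ : ∀ w {X} → (∀ c → X ≢ emb c) → ∀ c → emb w ⊕ X ≢ emb c
  outside-⊕ w {X} ∉img c eq =
    ∉img (w ⊕ c) (trans (sym (⊕-cancelˡ (emb w) X)) (trans (cong (emb w ⊕_) eq) (sym (emb-⊕ w c))))

  lift-shift : ∀ φ w → (λ X → lift φ (emb w ⊕ X)) ≈ᴳ lift (λ c → φ (w ⊕ c))
  lift-shift φ w = ≈lift _ onImage (λ X ∉img → lift-outside φ (outside-⊕ w ∉img))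
    where
    onImage : ∀ c → lift φ (emb w ⊕ emb c) ≡ φ (w ⊕ c)
    onImage c = trans (cong (lift φ) (sym (emb-⊕ w c))) (lift-emb φ (w ⊕ c))

  lift-minus : ∀ φ ψ → (lift φ -ᴳ lift ψ) ≈ᴳ lift (φ -ᴳ ψ)
  lift-minus φ ψ = ≈lift (φ -ᴳ ψ) (λ c → cong₂ ℤ._-_ (lift-emb φ c) (lift-emb ψ c))
                              (λ X ∉img → cong₂ ℤ._-_ (lift-outside φ ∉img) (lift-outside ψ ∉img))

  1−⟦emb⟧ : ∀ a → (𝟙 -ᴳ ⟦ emb a ⟧) ≈ᴳ lift (𝟙 -ᴳ ⟦ a ⟧)
  1−⟦emb⟧ a X = trans (cong₂ ℤ._-_ 𝟙≈ (⟦emb⟧ a X)) (lift-minus 𝟙 ⟦ a ⟧ X)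
    where
    𝟙≈ : 𝟙 X ≡ lift 𝟙 X
    𝟙≈ = trans (cong (λ B → ⟦ B ⟧ X) (sym emb-∅)) (⟦emb⟧ ∅ X)

  ·⟨1−emb⟩ : ∀ {f} φ a → f ≈ᴳ lift φ → (f ·⟨1− emb a ⟩) ≈ᴳ lift (φ ·⟨1− a ⟩)
  ·⟨1−emb⟩ φ a f≈ X = trans (·⟨1−⟩-congˡ (emb a) f≈ X)
                            (trans (cong (λ y → lift φ X ℤ.- y) (lift-shift φ a X)) (lift-minus φ _ X))

  form′-emb : ∀ a₁ a₂ a₃ a₄ a₅ →
              form′ (emb a₁) (emb a₂) (emb a₃) (emb a₄) (emb a₅) ≈ᴳ lift (form′ a₁ a₂ a₃ a₄ a₅)
  form′-emb a₁ a₂ a₃ a₄ a₅ X = trans (-ᴳ-cong first second X) (lift-minus _ _ X)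
    where
    triple : emb (a₁ ⊕ (a₂ ⊕ a₃)) ≡ emb a₁ ⊕ (emb a₂ ⊕ emb a₃)
    triple = trans (emb-⊕ a₁ _) (cong (emb a₁ ⊕_) (emb-⊕ a₂ a₃))
    first : ((𝟙 -ᴳ ⟦ emb a₁ ⟧) ·⟨1− emb a₂ ⟩ ·⟨1− emb a₃ ⟩) ≈ᴳ lift ((𝟙 -ᴳ ⟦ a₁ ⟧) ·⟨1− a₂ ⟩ ·⟨1− a₃ ⟩)
    first = ·⟨1−emb⟩ _ a₃ (·⟨1−emb⟩ _ a₂ (1−⟦emb⟧ a₁))
    second : ((𝟙 -ᴳ ⟦ emb a₄ ⟧) ·⟨1− emb a₅ ⟩ ·⟨1− emb a₁ ⊕ (emb a₂ ⊕ emb a₃) ⟩) ≈ᴳ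
             lift ((𝟙 -ᴳ ⟦ a₄ ⟧) ·⟨1− a₅ ⟩ ·⟨1− a₁ ⊕ (a₂ ⊕ a₃) ⟩)
    second = subst (λ B → ((𝟙 -ᴳ ⟦ emb a₄ ⟧) ·⟨1− emb a₅ ⟩ ·⟨1− B ⟩) ≈ᴳ lift _) triple
                   (·⟨1−emb⟩ _ (a₁ ⊕ (a₂ ⊕ a₃)) (·⟨1−emb⟩ _ a₅ (1−⟦emb⟧ a₄)))

  ∑-emb : ∀ (g : Subset n → ℕ) → (∀ X → (∀ c → X ≢ emb c) → g X ≡ 0) → ℕSum.∑ g ≡ ℕSum.∑ (g ∘ emb)
  ∑-emb g vanishes = begin
    ℕSum.∑ g                                  ≡⟨ ℕSum.∑-cong fibre ⟨
    ℕSum.∑ (λ X → ℕSum.∑ (δ X))               ≡⟨ ℕSum.sumOver-swap (allSubsets n) (allSubsets m) δ ⟩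
    ℕSum.∑ (λ c → ℕSum.∑ (λ X → δ X c))       ≡⟨ ℕSum.∑-cong (λ c → ℕSum.∑-cong (λ X → if-≟ˢ g 0 X (emb c))) ⟩
    ℕSum.∑ (λ c → ℕSum.∑ (λ X → if ⌊ X ≟ˢ emb c ⌋ then g (emb c) else 0))
                                              ≡⟨ ℕSum.∑-cong (λ c → ℕSum.∑-delta (emb c) (g (emb c))) ⟩
    ℕSum.∑ (g ∘ emb)                          ∎
    where
    open ≡-Reasoning
    δ : Subset n → Subset m → ℕ
    δ X c = if ⌊ X ≟ˢ emb c ⌋ then g X else 0
    fibre : ∀ X → ℕSum.∑ (δ X) ≡ g X
    fibre X with image? X
    ... | inj₁ (c₀ , refl) = trans (ℕSum.∑-cong same) (ℕSum.∑-delta c₀ (g (emb c₀)))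
      where
      same : ∀ c → δ (emb c₀) c ≡ (if ⌊ c ≟ˢ c₀ ⌋ then g (emb c₀) else 0)
      same c with c ≟ˢ c₀
      ... | yes refl = cong (if_then g (emb c) else 0) (⌊⌋-true (emb c ≟ˢ emb c) refl)
      ... | no  c≢c₀ =
        cong (if_then g (emb c₀) else 0) (⌊⌋-false (emb c₀ ≟ˢ emb c) (c≢c₀ ∘ sym ∘ emb-injective))
    ... | inj₂ ∉img = trans (ℕSum.∑-cong (λ c → cong (if_then g X else 0) (⌊⌋-false (X ≟ˢ emb c) (∉img c))))
                            (trans (ℕSum.sumOver-ε (allSubsets m)) (sym (vanishes X ∉img)))

  count-emb : ∀ (f : ℤ → ℕ) → f 0ℤ ≡ 0 → ∀ (U : GR n) → (∀ X → (∀ c → X ≢ emb c) → U X ≡ 0ℤ) →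
              ∀ A (A′ : Subset m) → (∀ c → ⌊ A Subsetₚ.⊆? emb c ⌋ ≡ ⌊ A′ Subsetₚ.⊆? c ⌋) →
              Σ⊆ℕ (λ X → if ⌊ A Subsetₚ.⊆? X ⌋ then f (U X) else 0) ≡
              Σ⊆ℕ (λ c → if ⌊ A′ Subsetₚ.⊆? c ⌋ then f (U (emb c)) else 0)
  count-emb f f0≡0 U vanishes A A′ A⊆≡ =
    trans (∑-emb _ zero-off) (ℕSum.∑-cong λ c → cong (if_then f (U (emb c)) else 0) (A⊆≡ c))
    where
    zero-off : ∀ X → (∀ c → X ≢ emb c) → (if ⌊ A Subsetₚ.⊆? X ⌋ then f (U X) else 0) ≡ 0
    zero-off X ∉img rewrite vanishes X ∉img | f0≡0 = Boolₚ.if-eta ⌊ A Subsetₚ.⊆? X ⌋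

  ⌊⊆?⌋-emb : ∀ j k c → ⌊ ⁅ pt j ⁆ ∪ ⁅ pt k ⁆ Subsetₚ.⊆? emb c ⌋ ≡ ⌊ ⁅ j ⁆ ∪ ⁅ k ⁆ Subsetₚ.⊆? c ⌋
  ⌊⊆?⌋-emb j k c = trans (⌊⊆?⌋-⁅⁆∪⁅⁆ (pt j) (pt k) (emb c))
                         (trans (cong₂ _∧_ (lookup-emb-pt c j) (lookup-emb-pt c k)) (sym (⌊⊆?⌋-⁅⁆∪⁅⁆ j k c)))

  trade-on-pairs : ∀ {U : GR n} → IsTrade 2 U → (∀ X → (∀ c → X ≢ emb c) → U X ≡ 0ℤ) →
                   ∀ j k → count₊ (U ∘ emb) (⁅ j ⁆ ∪ ⁅ k ⁆) ≡ count₋ (U ∘ emb) (⁅ j ⁆ ∪ ⁅ k ⁆)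
  trade-on-pairs {U} trade vanishes j k = begin
    count₊ (U ∘ emb) (⁅ j ⁆ ∪ ⁅ k ⁆)  ≡⟨ count-emb pos refl U vanishes A (⁅ j ⁆ ∪ ⁅ k ⁆) (⌊⊆?⌋-emb j k) ⟨
    count₊ U A                       ≡⟨ trade _ (∣⁅x⁆∪⁅y⁆∣≤2 (pt j) (pt k)) A refl ⟩
    count₋ U A                       ≡⟨ count-emb neg refl U vanishes A (⁅ j ⁆ ∪ ⁅ k ⁆) (⌊⊆?⌋-emb j k) ⟩
    count₋ (U ∘ emb) (⁅ j ⁆ ∪ ⁅ k ⁆)  ∎
    where
    open ≡-Reasoning
    A : Subset n
    A = ⁅ pt j ⁆ ∪ ⁅ pt k ⁆

  emb-nonempty : ∀ {a} → Nonempty a → Nonempty (emb a)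
  emb-nonempty {a} (k , k∈a) = pt k , lookup⇒∈ (trans (lookup-emb-pt a k) (∈⇒lookup k∈a))

  emb-disjoint : ∀ {a b} → Disjoint a b → Disjoint (emb a) (emb b)
  emb-disjoint {a} {b} a∩b≡∅ = lookup-ext λ i → begin
    lookup (emb a ∩ emb b) i                       ≡⟨ lookup-∩ (emb a) (emb b) i ⟩
    lookup (emb a) i ∧ lookup (emb b) i            ≡⟨ cong₂ _∧_ (lookup-emb a i) (lookup-emb b i) ⟩
    dot a (column gens i) ∧ dot b (column gens i)
      ≡⟨ dot-disjoint a b _ (column-atMostOne gens-disjoint i) a∩b≡∅ ⟩
    false                                          ≡⟨ lookup-∅ i ⟨
    lookup ∅ i                                     ∎
    where open ≡-Reasoning

  emb-admissible : ∀ {a₁ a₂ a₃ a₄ a₅} → Admissible a₁ a₂ a₃ a₄ a₅ →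
                   Admissible (emb a₁) (emb a₂) (emb a₃) (emb a₄) (emb a₅)
  emb-admissible ((n₁ , n₂ , n₃ , n₄ , n₅) , (d₁₂ , d₁₃ , d₁₄ , d₁₅ , d₂₃ , d₂₄ , d₂₅ , d₃₄ , d₃₅ , d₄₅)) =
    (emb-nonempty n₁ , emb-nonempty n₂ , emb-nonempty n₃ , emb-nonempty n₄ , emb-nonempty n₅) ,
    (emb-disjoint d₁₂ , emb-disjoint d₁₃ , emb-disjoint d₁₄ , emb-disjoint d₁₅ , emb-disjoint d₂₃ ,
     emb-disjoint d₂₄ , emb-disjoint d₂₅ , emb-disjoint d₃₄ , emb-disjoint d₃₅ , emb-disjoint d₄₅)

-- Projections without cancellation

+-≤-≡ : ∀ {a b c d} → a ℕ.≤ b → c ℕ.≤ d → a ℕ.+ c ≡ b ℕ.+ d → a ≡ b × c ≡ d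
+-≤-≡ {a} {b} {c} {d} a≤b c≤d eq = a≡b , ℕₚ.+-cancelˡ-≡ a c d (trans eq (cong (ℕ._+ d) (sym a≡b)))
  where
  a≡b : a ≡ b
  a≡b = ℕₚ.≤-antisym a≤b (ℕₚ.+-cancelʳ-≤ d b a (ℕₚ.≤-trans (ℕₚ.≤-reflexive (sym eq)) (ℕₚ.+-monoʳ-≤ a c≤d)))

sumOver-≤ : ∀ {X : Set} {f g : X → ℕ} → (∀ x → f x ℕ.≤ g x) → ∀ xs → ℕSum.sumOver xs f ℕ.≤ ℕSum.sumOver xs g
sumOver-≤ f≤g []       = z≤n
sumOver-≤ f≤g (x ∷ xs) = ℕₚ.+-mono-≤ (f≤g x) (sumOver-≤ f≤g xs)

sumOver-≤-≡ : ∀ {X : Set} {f g : X → ℕ} → (∀ x → f x ℕ.≤ g x) → ∀ xs →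
              ℕSum.sumOver xs f ≡ ℕSum.sumOver xs g → ∀ {x} → x List.∈ xs → f x ≡ g x
sumOver-≤-≡ f≤g (y ∷ ys) eq (here refl)  = proj₁ (+-≤-≡ (f≤g y) (sumOver-≤ f≤g ys) eq)
sumOver-≤-≡ f≤g (y ∷ ys) eq (there x∈ys) =
  sumOver-≤-≡ f≤g ys (proj₂ (+-≤-≡ (f≤g y) (sumOver-≤ f≤g ys) eq)) x∈ys

∑-≤-≡ : ∀ {n} {f g : Subset n → ℕ} → (∀ X → f X ℕ.≤ g X) → ℕSum.∑ f ≡ ℕSum.∑ g → ∀ X → f X ≡ g X
∑-≤-≡ {n} f≤g eq X = sumOver-≤-≡ f≤g (allSubsets n) eq (∈-allSubsets X)

pos-mono-≤ : ∀ {z w} → z ℤ.≤ w → pos z ℕ.≤ pos w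
pos-mono-≤ (ℤ.-≤- _)  = z≤n
pos-mono-≤ ℤ.-≤+      = z≤n
pos-mono-≤ (ℤ.+≤+ le) = le

pos-subadditive : ∀ a b → pos (a ℤ.+ b) ℕ.≤ pos a ℕ.+ pos b
pos-subadditive (+ m)    (+ k)    = ℕₚ.≤-refl
pos-subadditive (+ m)    -[1+ k ] = ℕₚ.≤-trans (pos-mono-≤ (ℤₚ.m⊖n≤m m (ℕ.suc k))) (ℕₚ.m≤m+n m 0)
pos-subadditive -[1+ m ] (+ k)    = pos-mono-≤ (ℤₚ.m⊖n≤m k (ℕ.suc m))
pos-subadditive -[1+ m ] -[1+ k ] = z≤n

neg-subadditive : ∀ a b → neg (a ℤ.+ b) ℕ.≤ neg a ℕ.+ neg b
neg-subadditive a b rewrite ℤₚ.neg-distrib-+ a b = pos-subadditive (ℤ.- a) (ℤ.- b)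

pos≡0⊎neg≡0 : ∀ z → pos z ≡ 0 ⊎ neg z ≡ 0
pos≡0⊎neg≡0 (+ ℕ.zero)  = inj₁ refl
pos≡0⊎neg≡0 (+ ℕ.suc m) = inj₂ refl
pos≡0⊎neg≡0 -[1+ m ]    = inj₁ refl

sign-coherent-sum : ∀ a b → pos (a ℤ.+ b) ≡ pos a ℕ.+ pos b → neg (a ℤ.+ b) ≡ neg a ℕ.+ neg b →
                    ℤ.∣ a ℤ.+ b ∣ ℕ.≤ 1 → a ≡ 0ℤ ⊎ b ≡ 0ℤ
sign-coherent-sum (+ ℕ.zero)  b           _  _  _ = inj₁ refl
sign-coherent-sum (+ ℕ.suc m) (+ ℕ.zero)  _  _  _ = inj₂ refl
sign-coherent-sum -[1+ m ]    (+ ℕ.zero)  _  _  _ = inj₂ refl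
sign-coherent-sum (+ ℕ.suc m) (+ ℕ.suc k) _  _  (s≤s le) with () ← ℕₚ.m+n≤o⇒n≤o m le
sign-coherent-sum -[1+ m ]    -[1+ k ]    _  _  (s≤s ())
sign-coherent-sum (+ ℕ.suc m) -[1+ k ]    p≡ n≡ _ with pos≡0⊎neg≡0 (+ ℕ.suc m ℤ.+ -[1+ k ])
... | inj₁ p≡0 with () ← trans (sym p≡0) p≡
... | inj₂ n≡0 with () ← trans (sym n≡0) n≡
sign-coherent-sum -[1+ m ]    (+ ℕ.suc k) p≡ n≡ _ with pos≡0⊎neg≡0 (-[1+ m ] ℤ.+ + ℕ.suc k)
... | inj₁ p≡0 with () ← trans (sym p≡0) p≡
... | inj₂ n≡0 with () ← trans (sym n≡0) n≡

trade-volume : ∀ {n t} {U : GR n} → IsTrade t U → vol U ≡ ℕSum.∑ (neg ∘ U)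
trade-volume {n} {U = U} trade = begin
  vol U         ≡⟨ ℕSum.∑-cong (λ X → cong (if_then pos (U X) else 0) (∅⊆ X)) ⟨
  count₊ U ∅    ≡⟨ trade 0 z≤n ∅ (Subsetₚ.∣⊥∣≡0 n) ⟩
  count₋ U ∅    ≡⟨ ℕSum.∑-cong (λ X → cong (if_then neg (U X) else 0) (∅⊆ X)) ⟩
  ℕSum.∑ (neg ∘ U) ∎
  where
  open ≡-Reasoning
  ∅⊆ : ∀ X → ⌊ ∅ Subsetₚ.⊆? X ⌋ ≡ true
  ∅⊆ X = ⌊⌋-true (∅ Subsetₚ.⊆? X) (Subsetₚ.⊆-min X)

count₊-cong : ∀ {n} {U V : GR n} → U ≈ᴳ V → ∀ A → count₊ U A ≡ count₊ V A
count₊-cong U≈V A = ℕSum.∑-cong λ X → cong (λ z → if ⌊ A Subsetₚ.⊆? X ⌋ then pos z else 0) (U≈V X)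

count₋-cong : ∀ {n} {U V : GR n} → U ≈ᴳ V → ∀ A → count₋ U A ≡ count₋ V A
count₋-cong U≈V A = ℕSum.∑-cong λ X → cong (λ z → if ⌊ A Subsetₚ.⊆? X ⌋ then neg z else 0) (U≈V X)

module Projection {n} (s : Fin n) (T T′ : GR n) (T≈proj : T ≈ᴳ proj s T′) where

  T-fibre : ∀ X → lookup X s ≡ false → T X ≡ T′ X ℤ.+ T′ (X ⊕ ⁅ s ⁆)
  T-fibre X s∉X =
    trans (T≈proj X) (cong (λ b → if b then 0ℤ else T′ X ℤ.+ T′ (X ⊕ ⁅ s ⁆)) (trans (⌊∈?⌋ s X) s∉X))

  -- Pointwise subadditivity together with equal totals forces pointwise equality.
  additive-on-fibres : ∀ (f : ℤ → ℕ) → f 0ℤ ≡ 0 → (∀ a b → f (a ℤ.+ b) ℕ.≤ f a ℕ.+ f b) →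
                       ℕSum.∑ (f ∘ T′) ≡ ℕSum.∑ (f ∘ T) →
                       ∀ X → lookup X s ≡ false → f (T X) ≡ f (T′ X) ℕ.+ f (T′ (X ⊕ ⁅ s ⁆))
  additive-on-fibres f f0≡0 subadditive preserved X s∉X =
    trans (cong f (T-fibre X s∉X))
          (subst (λ b → (if b then 0 else fsum X) ≡ (if b then 0 else sumf X)) s∉X (∑-≤-≡ F≤G F≡G X))
    where
    fsum sumf F G : Subset n → ℕ
    fsum X = f (T′ X ℤ.+ T′ (X ⊕ ⁅ s ⁆))
    sumf X = f (T′ X) ℕ.+ f (T′ (X ⊕ ⁅ s ⁆))
    F X = if lookup X s then 0 else fsum X
    G X = if lookup X s then 0 else sumf X
    F≤G : ∀ X → F X ℕ.≤ G X
    F≤G X with lookup X s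
    ... | true  = z≤n
    ... | false = subadditive _ _
    fT≡F : ∀ X → f (T X) ≡ F X
    fT≡F X = begin
      f (T X)                                                        ≡⟨ cong f (T≈proj X) ⟩
      f (if ⌊ s Subsetₚ.∈? X ⌋ then 0ℤ else T′ X ℤ.+ T′ (X ⊕ ⁅ s ⁆)) ≡⟨ Boolₚ.if-float f ⌊ s Subsetₚ.∈? X ⌋ ⟩
      (if ⌊ s Subsetₚ.∈? X ⌋ then f 0ℤ else fsum X)
        ≡⟨ cong₂ (if_then_else fsum X) (⌊∈?⌋ s X) f0≡0 ⟩
      F X                                                            ∎
      where open ≡-Reasoning
    F≡G : ℕSum.∑ F ≡ ℕSum.∑ G
    F≡G = trans (sym (ℕSum.∑-cong fT≡F)) (trans (sym preserved) (ℕSum.∑-pairs s (f ∘ T′)))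

  no-cancellation : (∀ X → ℤ.∣ T X ∣ ℕ.≤ 1) → vol T′ ≡ vol T → ℕSum.∑ (neg ∘ T′) ≡ ℕSum.∑ (neg ∘ T) →
                    ∀ X → lookup X s ≡ false →
                    (T′ X ≡ 0ℤ × T′ (X ⊕ ⁅ s ⁆) ≡ T X) ⊎ (T′ X ≡ T X × T′ (X ⊕ ⁅ s ⁆) ≡ 0ℤ)
  no-cancellation small vol≡ neg≡ X s∉X
    with sign-coherent-sum (T′ X) (T′ (X ⊕ ⁅ s ⁆))
           (trans (cong pos (sym (T-fibre X s∉X))) (additive-on-fibres pos refl pos-subadditive vol≡ X s∉X))
           (trans (cong neg (sym (T-fibre X s∉X))) (additive-on-fibres neg refl neg-subadditive neg≡ X s∉X))
           (subst (λ z → ℤ.∣ z ∣ ℕ.≤ 1) (T-fibre X s∉X) (small X))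
  ... | inj₁ a≡0 =
    inj₁ (a≡0 , sym (trans (T-fibre X s∉X) (trans (cong (ℤ._+ T′ (X ⊕ ⁅ s ⁆)) a≡0) (ℤₚ.+-identityˡ _))))
  ... | inj₂ b≡0 =
    inj₂ (sym (trans (T-fibre X s∉X) (trans (cong (λ b → T′ X ℤ.+ b) b≡0) (ℤₚ.+-identityʳ _))) , b≡0)

-- The trade T in coordinates, and the exhaustive check

∀-decide : ∀ {n} {P : Subset n → Set} (P? : ∀ X → Dec (P X)) → {True (all? P? (allSubsets n))} → ∀ X → P X
∀-decide P? {holds} X = ListAll.lookup (toWitness holds) (∈-allSubsets X)

sgn : Bool → ℤ
sgn b = if b then -1ℤ else 1ℤ

-- T in the coordinates Y₁ Y₂ Y₃ Z₁ Z₂, expanded by hand (see τ-form′) because the exhaustive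
-- check evaluates it very often: (1 − Y₁)(1 − Y₂)(1 − Y₃) lives on the subsets of Y₁Y₂Y₃, and
-- (1 − Z₁)(1 − Z₂)(1 − Y₁Y₂Y₃) on the d with y₁ = y₂ = y₃.
τ : GR 5
τ (y₁ ∷ y₂ ∷ y₃ ∷ z₁ ∷ z₂ ∷ []) =
  (if z₁ ∨ z₂ then 0ℤ else sgn y₁ ℤ.* sgn y₂ ℤ.* sgn y₃)
  ℤ.- (if (y₁ xor y₂) ∨ (y₁ xor y₃) then 0ℤ else sgn z₁ ℤ.* sgn z₂ ℤ.* sgn y₁)

τ-form′ : ∀ d → form′ ⁅ # 0 ⁆ ⁅ # 1 ⁆ ⁅ # 2 ⁆ ⁅ # 3 ⁆ ⁅ # 4 ⁆ d ≡ τ d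
τ-form′ = ∀-decide λ d → form′ ⁅ # 0 ⁆ ⁅ # 1 ⁆ ⁅ # 2 ⁆ ⁅ # 3 ⁆ ⁅ # 4 ⁆ d ℤ.≟ τ d

τ-small : ∀ d → ℤ.∣ τ d ∣ ℕ.≤ 1
τ-small = ∀-decide λ d → ℤ.∣ τ d ∣ ℕ.≤? 1

τ-generator : ∀ k → τ ⁅ k ⁆ ≢ 0ℤ
τ-generator zero                      ()
τ-generator (suc zero)                ()
τ-generator (suc (suc zero))          ()
τ-generator (suc (suc (suc zero)))    ()
τ-generator (suc (suc (suc (suc zero)))) ()

blocks : Vec (Subset 5) 12
blocks =
  (true  ∷ false ∷ false ∷ false ∷ false ∷ []) ∷
  (false ∷ true  ∷ false ∷ false ∷ false ∷ []) ∷
  (false ∷ false ∷ true  ∷ false ∷ false ∷ []) ∷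
  (true  ∷ true  ∷ false ∷ false ∷ false ∷ []) ∷
  (true  ∷ false ∷ true  ∷ false ∷ false ∷ []) ∷
  (false ∷ true  ∷ true  ∷ false ∷ false ∷ []) ∷
  (false ∷ false ∷ false ∷ true  ∷ false ∷ []) ∷
  (false ∷ false ∷ false ∷ false ∷ true  ∷ []) ∷
  (false ∷ false ∷ false ∷ true  ∷ true  ∷ []) ∷
  (true  ∷ true  ∷ true  ∷ true  ∷ false ∷ []) ∷
  (true  ∷ true  ∷ true  ∷ false ∷ true  ∷ []) ∷
  (true  ∷ true  ∷ true  ∷ true  ∷ true  ∷ []) ∷ []

indexOf : ∀ {m k} → Vec (Subset m) (ℕ.suc k) → Subset m → Fin (ℕ.suc k)
indexOf (_ ∷ [])     d = zero
indexOf (x ∷ y ∷ xs) d = if does (x ≟ˢ d) then zero else suc (indexOf (y ∷ xs) d)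

τ-support : ∀ d → τ d ≡ 0ℤ ⊎ lookup blocks (indexOf blocks d) ≡ d
τ-support = ∀-decide λ d → τ d ℤ.≟ 0ℤ ⊎-dec lookup blocks (indexOf blocks d) ≟ˢ d

-- Coordinate zero of 2⁶ is the new point s.  Without cancellation each block d of T occurs in
-- T′ as d or as d ∪ {s}; bit k of a choice says which, for the k-th block.
Choice : Set
Choice = Subset 12

τ′ : Choice → GR 6
τ′ β (x ∷ d) = if x xor lookup β (indexOf blocks d) then 0ℤ else τ d

Consistent : Choice → Set
Consistent β = ∀ j → count₊ (τ′ β) (⁅ zero ⁆ ∪ ⁅ j ⁆) ≡ count₋ (τ′ β) (⁅ zero ⁆ ∪ ⁅ j ⁆)

consistent? : ∀ β → Dec (Consistent β)
consistent? β = Finₚ.all? λ j → count₊ (τ′ β) (⁅ zero ⁆ ∪ ⁅ j ⁆) ℕ.≟ count₋ (τ′ β) (⁅ zero ⁆ ∪ ⁅ j ⁆)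

record Shift : Set where
  constructor shift
  field W Y₁ Y₂ Y₃ Z₁ Z₂ : Subset 6

Fits : Choice → Shift → Set
Fits β (shift W Y₁ Y₂ Y₃ Z₁ Z₂) =
  ListAll.All (λ c → τ′ β (W ⊕ c) ≡ form′ Y₁ Y₂ Y₃ Z₁ Z₂ c) (allSubsets 6) × Admissible Y₁ Y₂ Y₃ Z₁ Z₂

admissible? : ∀ {n} (Y₁ Y₂ Y₃ Z₁ Z₂ : Subset n) → Dec (Admissible Y₁ Y₂ Y₃ Z₁ Z₂)
admissible? Y₁ Y₂ Y₃ Z₁ Z₂ =
  (nonempty? Y₁ ×-dec nonempty? Y₂ ×-dec nonempty? Y₃ ×-dec nonempty? Z₁ ×-dec nonempty? Z₂) ×-dec
  (disjoint? Y₁ Y₂ ×-dec disjoint? Y₁ Y₃ ×-dec disjoint? Y₁ Z₁ ×-dec disjoint? Y₁ Z₂ ×-dec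
   disjoint? Y₂ Y₃ ×-dec disjoint? Y₂ Z₁ ×-dec disjoint? Y₂ Z₂ ×-dec
   disjoint? Y₃ Z₁ ×-dec disjoint? Y₃ Z₂ ×-dec disjoint? Z₁ Z₂)
  where
  disjoint? : ∀ A B → Dec (Disjoint A B)
  disjoint? A B = A ∩ B ≟ˢ ∅

fits? : ∀ β σ → Dec (Fits β σ)
fits? β (shift W Y₁ Y₂ Y₃ Z₁ Z₂) =
  all? (λ c → τ′ β (W ⊕ c) ℤ.≟ form′ Y₁ Y₂ Y₃ Z₁ Z₂ c) (allSubsets 6) ×-dec admissible? Y₁ Y₂ Y₃ Z₁ Z₂

-- The candidates: shifts by ∅ or {s} of the form with s adjoined to at most one of the sets.
adjoin : Maybe (Fin 5) → Fin 5 → Subset 6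
adjoin nothing  i = ⁅ suc i ⁆
adjoin (just k) i = if does (k Finₚ.≟ i) then ⁅ zero ⁆ ∪ ⁅ suc i ⁆ else ⁅ suc i ⁆

candidates : List Shift
candidates = List.cartesianProductWith candidate (∅ ∷ ⁅ zero ⁆ ∷ []) (nothing ∷ List.map just (List.allFin 5))
  where
  candidate : Subset 6 → Maybe (Fin 5) → Shift
  candidate W k = shift W (adjoin k (# 0)) (adjoin k (# 1)) (adjoin k (# 2)) (adjoin k (# 3)) (adjoin k (# 4))

certificate : ∀ β → Consistent β → Σ Shift (Fits β)
certificate β consistent =
  Any.satisfied (∀-decide (λ β → consistent? β →-dec any? (fits? β) candidates) β consistent)

-- Extensions of T

ShiftOfForm : ∀ {n} → GR n → Set
ShiftOfForm {n} T′ =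
  Σ (Subset n) λ W → Σ (Subset n) λ Y₁′ → Σ (Subset n) λ Y₂′ → Σ (Subset n) λ Y₃′ →
  Σ (Subset n) λ Z₁′ → Σ (Subset n) λ Z₂′ →
  Admissible Y₁′ Y₂′ Y₃′ Z₁′ Z₂′ × (⟦ W ⟧ *ᴳ T′) ≈ᴳ form Y₁′ Y₂′ Y₃′ Z₁′ Z₂′

form′-cong : ∀ {n} {A₁ A₂ A₃ A₄ A₅ B₁ B₂ B₃ B₄ B₅ : Subset n} →
             A₁ ≡ B₁ → A₂ ≡ B₂ → A₃ ≡ B₃ → A₄ ≡ B₄ → A₅ ≡ B₅ → form′ A₁ A₂ A₃ A₄ A₅ ≈ᴳ form′ B₁ B₂ B₃ B₄ B₅
form′-cong refl refl refl refl refl X = refl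

fibre-values : ∀ {u v t : ℤ} β → (u ≡ 0ℤ × v ≡ t) ⊎ (u ≡ t × v ≡ 0ℤ) → t ≡ 0ℤ ⊎ β ≡ ⌊ u ℤ.≟ 0ℤ ⌋ →
               u ≡ (if β then 0ℤ else t) × v ≡ (if β then t else 0ℤ)
fibre-values β (inj₁ (refl , refl)) (inj₁ refl) = sym (Boolₚ.if-eta β) , sym (Boolₚ.if-eta β)
fibre-values β (inj₂ (refl , refl)) (inj₁ refl) = sym (Boolₚ.if-eta β) , sym (Boolₚ.if-eta β)
fibre-values _ (inj₁ (refl , refl)) (inj₂ refl) = refl , refl
fibre-values {t = t} _ (inj₂ (refl , refl)) (inj₂ refl) with t ℤ.≟ 0ℤ
... | yes refl = refl , refl
... | no  _    = refl , refl

module Extension {n} (T : GR n) (Y₁ Y₂ Y₃ Z₁ Z₂ : Subset n) (T-trade : IsTrade 2 T)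
                 (admissible : Admissible Y₁ Y₂ Y₃ Z₁ Z₂) (T≈form : T ≈ᴳ form Y₁ Y₂ Y₃ Z₁ Z₂)
                 (T′ : GR n) (T′-trade : IsTrade 2 T′) (s : Fin n) (s-free : ∀ X → s ∈ X → T X ≡ 0ℤ)
                 (T≈proj : T ≈ᴳ proj s T′) (vol≡ : vol T′ ≡ vol T) where

  gens₅ : Vec (Subset n) 5
  gens₅ = Y₁ ∷ Y₂ ∷ Y₃ ∷ Z₁ ∷ Z₂ ∷ []

  pt₅ : Fin 5 → Fin n
  pt₅ k = proj₁ (Allₚ.lookup⁺ (admissible-nonempty admissible) k)

  pt₅∈gen : ∀ k → pt₅ k ∈ lookup gens₅ k
  pt₅∈gen k = proj₂ (Allₚ.lookup⁺ (admissible-nonempty admissible) k)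

  module C₅ = Coordinates gens₅ pt₅ (admissible-disjoint admissible) pt₅∈gen

  T≈lift₅ : T ≈ᴳ C₅.lift τ
  T≈lift₅ X = begin
    T X                     ≡⟨ T≈form X ⟩
    form Y₁ Y₂ Y₃ Z₁ Z₂ X   ≡⟨ form≈form′ Y₁ Y₂ Y₃ Z₁ Z₂ X ⟩
    form′ Y₁ Y₂ Y₃ Z₁ Z₂ X  ≡⟨ form′-cong (e (# 0)) (e (# 1)) (e (# 2)) (e (# 3)) (e (# 4)) X ⟨
    form′ (C₅.emb ⁅ # 0 ⁆) (C₅.emb ⁅ # 1 ⁆) (C₅.emb ⁅ # 2 ⁆) (C₅.emb ⁅ # 3 ⁆) (C₅.emb ⁅ # 4 ⁆) X
                            ≡⟨ C₅.form′-emb _ _ _ _ _ X ⟩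
    C₅.lift (form′ ⁅ # 0 ⁆ ⁅ # 1 ⁆ ⁅ # 2 ⁆ ⁅ # 3 ⁆ ⁅ # 4 ⁆) X
                            ≡⟨ C₅.lift-cong τ-form′ X ⟩
    C₅.lift τ X             ∎
    where
    open ≡-Reasoning
    e : ∀ k → C₅.emb ⁅ k ⁆ ≡ lookup gens₅ k
    e = C₅.emb-⁅⁆

  s∉gen : ∀ k → lookup (lookup gens₅ k) s ≡ false
  s∉gen k with lookup (lookup gens₅ k) s in s∈G
  ... | false = refl
  ... | true  = ⊥-elim (τ-generator k (begin
    τ ⁅ k ⁆                   ≡⟨ C₅.lift-emb τ ⁅ k ⁆ ⟨
    C₅.lift τ (C₅.emb ⁅ k ⁆)  ≡⟨ T≈lift₅ _ ⟨
    T (C₅.emb ⁅ k ⁆)          ≡⟨ cong T (C₅.emb-⁅⁆ k) ⟩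
    T (lookup gens₅ k)        ≡⟨ s-free _ (lookup⇒∈ s∈G) ⟩
    0ℤ                        ∎))
    where open ≡-Reasoning

  gens₆ : Vec (Subset n) 6
  gens₆ = ⁅ s ⁆ ∷ gens₅

  pt₆ : Fin 6 → Fin n
  pt₆ zero    = s
  pt₆ (suc k) = pt₅ k

  pt₆∈gen : ∀ k → pt₆ k ∈ lookup gens₆ k
  pt₆∈gen zero    = Subsetₚ.x∈⁅x⁆ s
  pt₆∈gen (suc k) = pt₅∈gen k

  module C₆ = Coordinates gens₆ pt₆ (Allₚ.lookup⁻ (⁅x⁆-disjoint ∘ s∉gen) ∷ admissible-disjoint admissible)
                          pt₆∈gen

  emb₆-true : ∀ d → C₆.emb (true ∷ d) ≡ C₅.emb d ⊕ ⁅ s ⁆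
  emb₆-true d = trans (cong (λ X → C₆.emb (true ∷ X)) (sym (⊕-identityʳ d)))
                      (trans (C₆.emb-⊕ (false ∷ d) ⁅ zero ⁆) (cong (C₅.emb d ⊕_) (C₆.emb-⁅⁆ zero)))

  open Projection s T T′ T≈proj

  fibre : ∀ X → lookup X s ≡ false → (T′ X ≡ 0ℤ × T′ (X ⊕ ⁅ s ⁆) ≡ T X) ⊎ (T′ X ≡ T X × T′ (X ⊕ ⁅ s ⁆) ≡ 0ℤ)
  fibre = no-cancellation small vol≡ neg≡
    where
    small : ∀ X → ℤ.∣ T X ∣ ℕ.≤ 1
    small X = subst (λ z → ℤ.∣ z ∣ ℕ.≤ 1) (sym (T≈lift₅ X)) (C₅.lift-preserves (λ z → ℤ.∣ z ∣ ℕ.≤ 1) z≤n τ-small X)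
    neg≡ : ℕSum.∑ (neg ∘ T′) ≡ ℕSum.∑ (neg ∘ T)
    neg≡ = trans (sym (trade-volume {U = T′} T′-trade)) (trans vol≡ (trade-volume {U = T} T-trade))

  fibre-zero : ∀ X → lookup X s ≡ false → T X ≡ 0ℤ → T′ X ≡ 0ℤ × T′ (X ⊕ ⁅ s ⁆) ≡ 0ℤ
  fibre-zero X s∉X TX≡0 with fibre X s∉X
  ... | inj₁ (u≡0 , v≡T) = u≡0 , trans v≡T TX≡0
  ... | inj₂ (u≡T , v≡0) = trans u≡T TX≡0 , v≡0

  T-off : ∀ X → (∀ c → X ≢ C₆.emb c) → T X ≡ 0ℤ
  T-off X ∉img = trans (T≈lift₅ X) (C₅.lift-outside τ (λ d → ∉img (false ∷ d)))

  T′-off : ∀ X → (∀ c → X ≢ C₆.emb c) → T′ X ≡ 0ℤ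
  T′-off X ∉img with lookup X s in s∈X
  ... | false = proj₁ (fibre-zero X s∈X (T-off X ∉img))
  ... | true  = trans (cong T′ (sym (⊕-cancelʳ X ⁅ s ⁆))) (proj₂ (fibre-zero X₀ s∉X₀ (T-off X₀ X₀∉img)))
    where
    X₀ : Subset n
    X₀ = X ⊕ ⁅ s ⁆
    s∉X₀ : lookup X₀ s ≡ false
    s∉X₀ = trans (lookup-⊕ X ⁅ s ⁆ s) (cong₂ _xor_ s∈X (∈⇒lookup (Subsetₚ.x∈⁅x⁆ s)))
    X₀∉img : ∀ c → X₀ ≢ C₆.emb c
    X₀∉img = subst (λ Y → ∀ c → Y ≢ C₆.emb c) (trans (cong (_⊕ X) (C₆.emb-⁅⁆ zero)) (⊕-comm ⁅ s ⁆ X))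
                   (C₆.outside-⊕ ⁅ zero ⁆ ∉img)

  T-coords : ∀ d → T (C₅.emb d) ≡ τ d
  T-coords d = trans (T≈lift₅ (C₅.emb d)) (C₅.lift-emb τ d)

  moved : Fin 12 → Bool
  moved k = ⌊ T′ (C₅.emb (lookup blocks k)) ℤ.≟ 0ℤ ⌋

  choice : Choice
  choice = tabulate moved

  fibre-values-at : ∀ d → let β = lookup choice (indexOf blocks d) in
                    T′ (C₅.emb d) ≡ (if β then 0ℤ else τ d) × T′ (C₅.emb d ⊕ ⁅ s ⁆) ≡ (if β then τ d else 0ℤ)
  fibre-values-at d = fibre-values β shape support
    where
    X₀ : Subset n
    X₀ = C₅.emb d
    β : Bool
    β = lookup choice (indexOf blocks d)
    shape : (T′ X₀ ≡ 0ℤ × T′ (X₀ ⊕ ⁅ s ⁆) ≡ τ d) ⊎ (T′ X₀ ≡ τ d × T′ (X₀ ⊕ ⁅ s ⁆) ≡ 0ℤ)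
    shape = subst (λ t → (T′ X₀ ≡ 0ℤ × T′ (X₀ ⊕ ⁅ s ⁆) ≡ t) ⊎ (T′ X₀ ≡ t × T′ (X₀ ⊕ ⁅ s ⁆) ≡ 0ℤ))
                  (T-coords d) (fibre X₀ (C₆.lookup-emb-pt (false ∷ d) zero))
    support : τ d ≡ 0ℤ ⊎ β ≡ ⌊ T′ X₀ ℤ.≟ 0ℤ ⌋
    support with τ-support d
    ... | inj₁ τd≡0   = inj₁ τd≡0
    ... | inj₂ block≡d = inj₂ (trans (Vecₚ.lookup∘tabulate moved (indexOf blocks d))
                                     (cong (λ e → ⌊ T′ (C₅.emb e) ℤ.≟ 0ℤ ⌋) block≡d))

  T′-coords : ∀ c → T′ (C₆.emb c) ≡ τ′ choice c
  T′-coords (false ∷ d) = proj₁ (fibre-values-at d)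
  T′-coords (true  ∷ d) =
    trans (cong T′ (emb₆-true d))
          (trans (proj₂ (fibre-values-at d)) (sym (Boolₚ.if-not (lookup choice (indexOf blocks d)))))

  choice-consistent : Consistent choice
  choice-consistent j = begin
    count₊ (τ′ choice) (⁅ zero ⁆ ∪ ⁅ j ⁆)     ≡⟨ count₊-cong T′-coords (⁅ zero ⁆ ∪ ⁅ j ⁆) ⟨
    count₊ (T′ ∘ C₆.emb) (⁅ zero ⁆ ∪ ⁅ j ⁆)   ≡⟨ C₆.trade-on-pairs T′-trade T′-off zero j ⟩
    count₋ (T′ ∘ C₆.emb) (⁅ zero ⁆ ∪ ⁅ j ⁆)   ≡⟨ count₋-cong T′-coords (⁅ zero ⁆ ∪ ⁅ j ⁆) ⟩
    count₋ (τ′ choice) (⁅ zero ⁆ ∪ ⁅ j ⁆)     ∎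
    where open ≡-Reasoning

  realise : Σ Shift (Fits choice) → ShiftOfForm T′
  realise (shift W a₁ a₂ a₃ a₄ a₅ , fits , admissible′) =
    C₆.emb W , C₆.emb a₁ , C₆.emb a₂ , C₆.emb a₃ , C₆.emb a₄ , C₆.emb a₅ , C₆.emb-admissible admissible′ , shifted
    where
    shifted : (⟦ C₆.emb W ⟧ *ᴳ T′) ≈ᴳ form (C₆.emb a₁) (C₆.emb a₂) (C₆.emb a₃) (C₆.emb a₄) (C₆.emb a₅)
    shifted X = begin
      (⟦ C₆.emb W ⟧ *ᴳ T′) X                   ≡⟨ ⟦⟧-*ᴳ (C₆.emb W) T′ X ⟩
      T′ (C₆.emb W ⊕ X)                        ≡⟨ C₆.≈lift (τ′ choice) T′-coords T′-off (C₆.emb W ⊕ X) ⟩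
      C₆.lift (τ′ choice) (C₆.emb W ⊕ X)       ≡⟨ C₆.lift-shift (τ′ choice) W X ⟩
      C₆.lift (λ c → τ′ choice (W ⊕ c)) X      ≡⟨ C₆.lift-cong (λ c → ListAll.lookup fits (∈-allSubsets c)) X ⟩
      C₆.lift (form′ a₁ a₂ a₃ a₄ a₅) X         ≡⟨ C₆.form′-emb a₁ a₂ a₃ a₄ a₅ X ⟨
      form′ (C₆.emb a₁) (C₆.emb a₂) (C₆.emb a₃) (C₆.emb a₄) (C₆.emb a₅) X
        ≡⟨ form≈form′ (C₆.emb a₁) (C₆.emb a₂) (C₆.emb a₃) (C₆.emb a₄) (C₆.emb a₅) X ⟨
      form (C₆.emb a₁) (C₆.emb a₂) (C₆.emb a₃) (C₆.emb a₄) (C₆.emb a₅) X ∎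
      where open ≡-Reasoning

  shift-of-form : ShiftOfForm T′
  shift-of-form = realise (certificate choice choice-consistent)

proposition6p4 : ∀ {n : ℕ} (T : GR n) (Y₁ Y₂ Y₃ Z₁ Z₂ : Subset n) →
    IsTrade 2 T → vol T ≡ 6 → Admissible Y₁ Y₂ Y₃ Z₁ Z₂ →
    T ≈ᴳ form Y₁ Y₂ Y₃ Z₁ Z₂ →
    ∀ (T′ : GR n) → IsExtension 2 T T′ →
    Σ (Subset n) λ W → Σ (Subset n) λ Y₁′ → Σ (Subset n) λ Y₂′ → Σ (Subset n) λ Y₃′ →
      Σ (Subset n) λ Z₁′ → Σ (Subset n) λ Z₂′ →
        Admissible Y₁′ Y₂′ Y₃′ Z₁′ Z₂′ × (⟦ W ⟧ *ᴳ T′) ≈ᴳ form Y₁′ Y₂′ Y₃′ Z₁′ Z₂′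
proposition6p4 T Y₁ Y₂ Y₃ Z₁ Z₂ T-trade _ admissible T≈form T′ (T′-trade , (s , s-free , T≈proj) , vol≡) =
  Extension.shift-of-form T Y₁ Y₂ Y₃ Z₁ Z₂ T-trade admissible T≈form T′ T′-trade s s-free T≈proj vol≡
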